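{- Let $G=(V,E)$ be a connected, undirected, unweighted graph, $R\subseteq V$ a set of landmarks and $H=(R,\delta_H)$ the highway. Let $L$ be the labelling constructed by Algorithm 1 (described in the context). Then $L$ is minimal: for every highway cover distance labelling $L'$ over $(G,H)$, $size(L')\geq size(L)$.
   Context: $d_G(u,v)$ denotes the shortest-path distance in $G$. A vertex $x$ lies on a shortest path between $u$ and $w$ if $d_G(u,x)+d_G(x,w)=d_G(u,w)$. A highway is a pair $H=(R,\delta_H)$ with $\delta_H(r_1,r_2)=d_G(r_1,r_2)$ for all $r_1,r_2\in R$. A distance labelling assigns to each $v\in V\setminus R$ a label $L(v)$, a set of entries $(r,\delta_L(r,v))$ with $r\in R$ (at most one entry per landmark) and $\delta_L(r,v)=d_G(r,v)$; its size is $size(L)=\sum_{v}|L(v)|$. A highway cover distance labelling over $(G,H)$ is a distance labelling such that for all $s,t\in V\setminus R$ (not necessarily distinct) and every $r\in R$ there exist $(r_i,\delta_L(r_i,s))\in L(s)$ and $(r_j,\delta_L(r_j,t))\in L(t)$ such that $r_i$ lies on a shortest path between $r$ and $s$ and $r_j$ lies on a shortest path between $r$ and $t$ (possibly $r_i=r$ or $r_j=r$). Algorithm 1: initialise $L(v)=\emptyset$ for all $v\in V\setminus R$. For each $r_i\in R$ (in any order) run the following pruned BFS, in which each vertex is visited at most once and the root $r_i$ is visited at depth $0$. Keep two queues $\mathcal{Q}_{label}=\{r_i\}$ and $\mathcal{Q}_{prune}=\emptyset$ and set $n=0$. While $\mathcal{Q}_{label}$ contains vertices of depth $n$: (i) for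 each $u\in\mathcal{Q}_{label}$ at depth $n$ and each unvisited neighbour $v$ of $u$ (which becomes visited at depth $n+1$): if $v\in R$, enqueue $v$ to $\mathcal{Q}_{prune}$; otherwise enqueue $v$ to $\mathcal{Q}_{label}$ and add $(r_i,n+1)$ to $L(v)$; (ii) set $n\gets n+1$; (iii) for each $v\in\mathcal{Q}_{prune}$ at depth $n$, mark every unvisited neighbour of $v$ as visited at depth $n+1$ and enqueue it to $\mathcal{Q}_{prune}$ (no label is added). The output is $L$. -}

module Defs where

open import Data.Nat using (ℕ; zero; suc; _+_; _≤_)
open import Data.Bool using (Bool; true; false; _∧_; _∨_; not; if_then_else_)
open import Data.Fin using (Fin)
open import Data.List using (List; allFin; map)
open import Data.Nat.ListAction using (sum)
open import Data.Bool.ListAction using (any)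
open import Data.Maybe using (Maybe; just; nothing; is-just)
open import Data.Product using (Σ; ∃; _×_; _,_)
open import Relation.Binary.PropositionalEquality using (_≡_)

record Graph (n : ℕ) : Set where
  field
    E      : Fin n → Fin n → Bool
    sym    : ∀ u v → E u v ≡ E v u
    irrefl : ∀ u → E u u ≡ false
open Graph public

data Walk {n : ℕ} (G : Graph n) : Fin n → Fin n → ℕ → Set where
  here : ∀ {u} → Walk G u u 0
  step : ∀ {u w v k} → E G u w ≡ true → Walk G w v k → Walk G u v (suc k)

Connected : ∀ {n} → Graph n → Set
Connected G = ∀ u v → ∃ λ k → Walk G u v k

IsDist : ∀ {n} → Graph n → Fin n → Fin n → ℕ → Set
IsDist G u v d = Walk G u v d × (∀ k → Walk G u v k → d ≤ k)

OnShortestPath : ∀ {n} → Graph n → Fin n → Fin n → Fin n → Set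
OnShortestPath G u x w =
  Σ ℕ λ a → Σ ℕ λ b → Σ ℕ λ c →
    IsDist G u x a × IsDist G x w b × IsDist G u w c × (a + b ≡ c)

-- Landmarks R ⊆ V are given as a Boolean predicate.
-- A labelling: L v r = just d  means  (r , d) ∈ L(v)  (at most one entry per landmark).

Labelling : ℕ → Set
Labelling n = Fin n → Fin n → Maybe ℕ

IsDistanceLabelling : ∀ {n} → Graph n → (Fin n → Bool) → Labelling n → Set
IsDistanceLabelling G R L =
  ∀ v r d → R v ≡ false → L v r ≡ just d → (R r ≡ true) × IsDist G r v d

IsHighwayCoverLabelling : ∀ {n} → Graph n → (Fin n → Bool) → Labelling n → Set
IsHighwayCoverLabelling {n} G R L =
  IsDistanceLabelling G R L ×
  (∀ s t r → R s ≡ false → R t ≡ false → R r ≡ true →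
     (Σ (Fin n) λ ri → Σ ℕ λ di → (L s ri ≡ just di) × OnShortestPath G r ri s) ×
     (Σ (Fin n) λ rj → Σ ℕ λ dj → (L t rj ≡ just dj) × OnShortestPath G r rj t))

count : ∀ {n} → (Fin n → Bool) → ℕ
count {n} p = sum (map (λ x → if p x then 1 else 0) (allFin n))

size : ∀ {n} → (Fin n → Bool) → Labelling n → ℕ
size {n} R L =
  sum (map (λ v → if R v then 0 else count (λ r → is-just (L v r))) (allFin n))

-- Algorithm 1: pruned BFS from each landmark (level-synchronous simulation).
-- State before the label step at depth k:
--   vis : visited vertices
--   Lf  : vertices of Q_label at depth k
--   Pf  : vertices of Q_prune at depth k+1 (already visited)
--   lbl : label entries produced so far by this BFS (lbl v = just d ⇔ (root,d) added to L(v))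

record BFSState (n : ℕ) : Set where
  constructor st
  field
    vis : Fin n → Bool
    Lf  : Fin n → Bool
    Pf  : Fin n → Bool
    lbl : Fin n → Maybe ℕ

unvisitedNbrs : ∀ {n} → Graph n → (Fin n → Bool) → (Fin n → Bool) → Fin n → Bool
unvisitedNbrs {n} G vis S v = not (vis v) ∧ any (λ u → S u ∧ E G u v) (allFin n)

bfsRound : ∀ {n} → Graph n → (Fin n → Bool) → ℕ → BFSState n → BFSState n
bfsRound G R k (st vis Lf Pf lbl) =
  let N     = unvisitedNbrs G vis Lf                     -- (i) new vertices at depth k+1
      vis₁  = λ v → vis v ∨ N v
      Lnext = λ v → N v ∧ not (R v)                      -- enqueued to Q_label, labelled
      lbl₁  = λ v → if Lnext v then just (suc k) else lbl v
      Pfull = λ v → Pf v ∨ (N v ∧ R v)                   -- Q_prune at depth k+1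
      M     = unvisitedNbrs G vis₁ Pfull                 -- (iii) depth k+2, pruned
      vis₂  = λ v → vis₁ v ∨ M v
  in st vis₂ Lnext M lbl₁

bfsRun : ∀ {n} → Graph n → (Fin n → Bool) → ℕ → ℕ → BFSState n → BFSState n
bfsRun G R zero     k s = s
bfsRun G R (suc f) k s = bfsRun G R f (suc k) (bfsRound G R k s)

-- pruned BFS from root r; n rounds suffice (depths are < n; rounds with an
-- empty label frontier add nothing)
prunedBFS : ∀ {n} → Graph n → (Fin n → Bool) → Fin n → Fin n → Maybe ℕ
prunedBFS {n} G R r =
  BFSState.lbl (bfsRun G R n 0
    (st (λ v → is-eq v) (λ v → is-eq v) (λ _ → false) (λ _ → nothing)))
  where
  open import Data.Fin using (_≟_)
  open import Relation.Nullary.Decidable using (⌊_⌋)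
  is-eq : Fin n → Bool
  is-eq v = ⌊ v ≟ r ⌋

algorithm1 : ∀ {n} → Graph n → (Fin n → Bool) → Labelling n
algorithm1 G R v r = if R r then prunedBFS G R r v else nothing

-- Fix a landmark r and a non-landmark v.  The pruned BFS from r adds (r , d) to L(v) only if
--   (a) there is a walk of length d from r to v, and
--   (b) every walk from r to v that reaches some other landmark x ≠ r and then continues along
--       at least one edge to v is strictly longer than d
-- (vertices behind another landmark are only reached through the pruning queue, which never
-- labels).
--
-- Now let L′ be any highway cover labelling and apply the cover property to (v , v , r): L′(v)
-- has an entry for a hub rᵢ on a shortest r–v path.  If rᵢ ≠ r, then rᵢ is a landmark (L′ is a
-- distance labelling), rᵢ ≠ v (v is not a landmark), and the shortest path r ⇝ rᵢ ⇝ v violates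
-- (b) because its length d(r,v) is at most d.  Hence rᵢ = r, i.e. every landmark occurring in
-- L(v) occurs in L′(v), and size(L′) ≥ size(L) follows by monotonicity of counting.
module Submission where

open import Defs hiding (sym)
open import Data.Nat using (ℕ; _≥_; zero; suc; _+_; _≤_; _<_; z≤n; s≤s; s≤s⁻¹)
open import Data.Nat.Properties
  using (m≤n⇒m<n∨m≡n; ≰⇒>; +-suc; +-comm; suc-injective; ≤-refl; m≤n⇒m≤1+n; +-mono-≤; <⇒≱)
open import Data.Bool using (Bool; true; false; _∧_; _∨_; not; if_then_else_)
open import Data.Fin using (Fin; _≟_)
open import Data.List using (List; []; _∷_; allFin; map)
open import Data.Nat.ListAction using (sum)
open import Data.Bool.ListAction using (any)
open import Data.Maybe using (Maybe; just; nothing; is-just)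
open import Data.Product using (Σ; ∃; _×_; _,_; proj₁; proj₂)
open import Data.Sum using (_⊎_; inj₁; inj₂)
open import Data.Empty using (⊥-elim)
open import Relation.Nullary using (yes; no)
open import Relation.Nullary.Decidable using (⌊_⌋)
open import Relation.Binary.PropositionalEquality using (_≡_; _≢_; refl; sym; trans; subst)
open import Data.List.Relation.Unary.Any using (here; there)
open import Data.List.Membership.Propositional using (_∈_)
open import Data.List.Membership.Propositional.Properties using (∈-allFin)

true≢false : true ≢ false
true≢false ()

∨-introˡ : ∀ {a b} → a ≡ true → a ∨ b ≡ true
∨-introˡ refl = refl

∨-introʳ : ∀ {a b} → b ≡ true → a ∨ b ≡ true
∨-introʳ {true}  _ = refl
∨-introʳ {false} p = p

∨-elim : ∀ {a b} → a ∨ b ≡ true → a ≡ true ⊎ b ≡ true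
∨-elim {true}  _ = inj₁ refl
∨-elim {false} p = inj₂ p

∧-elim : ∀ {a b} → a ∧ b ≡ true → a ≡ true × b ≡ true
∧-elim {true} {true} _ = refl , refl

∧-intro : ∀ {a b} → a ≡ true → b ≡ true → a ∧ b ≡ true
∧-intro refl refl = refl

not-elim : ∀ {a} → not a ≡ true → a ≡ false
not-elim {false} _ = refl

any-witness : ∀ {A : Set} (p : A → Bool) (xs : List A) → any p xs ≡ true → ∃ λ x → p x ≡ true
any-witness p (x ∷ xs) h with ∨-elim {p x} h
... | inj₁ px = x , px
... | inj₂ rest = any-witness p xs rest

any-intro : ∀ {A : Set} (p : A → Bool) {xs : List A} {x} → x ∈ xs → p x ≡ true → any p xs ≡ true
any-intro p {y ∷ _} (here refl) px = ∨-introˡ {p y} px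
any-intro p {y ∷ _} (there x∈) px = ∨-introʳ {p y} (any-intro p x∈ px)

module _ {n : ℕ} (G : Graph n) where

  snoc : ∀ {a b c k} → Walk G a b k → E G b c ≡ true → Walk G a c (suc k)
  snoc here         e = step e here
  snoc (step e′ w) e = step e′ (snoc w e)

  unsnoc : ∀ {a c k} → Walk G a c (suc k) → ∃ λ b → Walk G a b k × (E G b c ≡ true)
  unsnoc (step e here) = _ , here , e
  unsnoc (step e (step e′ w)) with unsnoc (step e′ w)
  ... | b , w′ , e″ = b , step e w′ , e″

  walk-length-0 : ∀ {a b} → Walk G a b 0 → a ≡ b
  walk-length-0 here = refl

  unvisitedNbr-elim : ∀ vis S v → unvisitedNbrs G vis S v ≡ true →
    (vis v ≡ false) × (∃ λ u → (S u ≡ true) × (E G u v ≡ true))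
  unvisitedNbr-elim vis S v h with ∧-elim {not (vis v)} h
  ... | unvis , adj with any-witness (λ u → S u ∧ E G u v) (allFin n) adj
  ... | u , Su∧e = not-elim unvis , u , ∧-elim Su∧e

  unvisitedNbr-intro : ∀ vis S v u → vis v ≡ false → S u ≡ true → E G u v ≡ true →
    unvisitedNbrs G vis S v ≡ true
  unvisitedNbr-intro vis S v u unvis Su e rewrite unvis =
    any-intro (λ u → S u ∧ E G u v) (∈-allFin u) (∧-intro Su e)

  nbrs-covered : ∀ vis S u w → S u ≡ true → E G u w ≡ true → vis w ∨ unvisitedNbrs G vis S w ≡ true
  nbrs-covered vis S u w Su e = by-cases (vis w) refl
    where
    by-cases : ∀ b → vis w ≡ b → vis w ∨ unvisitedNbrs G vis S w ≡ true
    by-cases true  visited = ∨-introˡ {vis w} visited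
    by-cases false unvis   = ∨-introʳ {vis w} (unvisitedNbr-intro vis S w u unvis Su e)

≤-suc-cases : ∀ {j k} → j ≤ suc k → j ≤ k ⊎ j ≡ suc k
≤-suc-cases j≤ with m≤n⇒m<n∨m≡n j≤
... | inj₁ (s≤s j≤k) = inj₁ j≤k
... | inj₂ j≡ = inj₂ j≡

module PrunedBFS {n : ℕ} (G : Graph n) (R : Fin n → Bool) (r : Fin n) where

  -- A walk of length m from r to w that passes a landmark x ≠ r and then takes at least one
  -- more edge: such walks are exactly the ones the BFS refuses to label along.
  ViaLandmark : Fin n → ℕ → Set
  ViaLandmark w m = Σ (Fin n) λ x → (R x ≡ true) × (x ≢ r) × Σ ℕ λ a → Σ ℕ λ b →
    Walk G r x a × Walk G x w (suc b) × (a + suc b ≡ m)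

  SoundLabels : (Fin n → Maybe ℕ) → Set
  SoundLabels lbl = ∀ v d → lbl v ≡ just d → Walk G r v d × (∀ m → ViaLandmark v m → d < m)

  record Invariant (k : ℕ) (s : BFSState n) : Set where
    open BFSState s
    field
      near-visited     : ∀ w j → j ≤ k → Walk G r w j → vis w ≡ true
      via-visited      : ∀ w m → m ≤ suc k → ViaLandmark w m → vis w ≡ true
      depth-k-handled  : ∀ u → Walk G r u k → Lf u ≡ true ⊎ (∀ w → E G u w ≡ true → vis w ≡ true)
      visited-reason   : ∀ u → vis u ≡ true → (Σ ℕ λ j → j ≤ k × Walk G r u j) ⊎ Pf u ≡ true
      prune-at-depth   : ∀ u → Pf u ≡ true → Walk G r u (suc k)
      label-at-depth   : ∀ u → Lf u ≡ true → Walk G r u k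
      labels-sound     : SoundLabels lbl
  open Invariant

  module Round (k : ℕ) (vis Lf Pf : Fin n → Bool) (lbl : Fin n → Maybe ℕ)
               (inv : Invariant k (st vis Lf Pf lbl)) where
    N vis₁ Lnext Pfull M vis₂ : Fin n → Bool
    N     = unvisitedNbrs G vis Lf
    vis₁  = λ v → vis v ∨ N v
    Lnext = λ v → N v ∧ not (R v)
    Pfull = λ v → Pf v ∨ (N v ∧ R v)
    M     = unvisitedNbrs G vis₁ Pfull
    vis₂  = λ v → vis₁ v ∨ M v

    vis₁⇒vis₂ : ∀ w → vis₁ w ≡ true → vis₂ w ≡ true
    vis₁⇒vis₂ w = ∨-introˡ {vis₁ w}

    vis⇒vis₂ : ∀ w → vis w ≡ true → vis₂ w ≡ true
    vis⇒vis₂ w p = vis₁⇒vis₂ w (∨-introˡ {vis w} p)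

    near-visited′ : ∀ w j → j ≤ suc k → Walk G r w j → vis₂ w ≡ true
    near-visited′ w j j≤ walk with ≤-suc-cases j≤
    ... | inj₁ j≤k = vis⇒vis₂ w (near-visited inv w j j≤k walk)
    ... | inj₂ refl with unsnoc G walk
    ... | u , walk-u , e with depth-k-handled inv u walk-u
    ... | inj₁ Lu   = vis₁⇒vis₂ w (nbrs-covered G vis Lf u w Lu e)
    ... | inj₂ done = vis⇒vis₂ w (done w e)

    -- Previously visited vertices are near (so their neighbours are near) or pruned.
    nbrs-of-visited : ∀ u → vis u ≡ true → ∀ w → E G u w ≡ true → vis₂ w ≡ true
    nbrs-of-visited u vu w e with visited-reason inv u vu
    ... | inj₁ (j , j≤k , walk) = near-visited′ w (suc j) (s≤s j≤k) (snoc G walk e)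
    ... | inj₂ Pu = nbrs-covered G vis₁ Pfull u w (∨-introˡ {Pf u} Pu) e

    depth-k-handled′ : ∀ u → Walk G r u (suc k) →
      Lnext u ≡ true ⊎ (∀ w → E G u w ≡ true → vis₂ w ≡ true)
    depth-k-handled′ u walk with unsnoc G walk
    ... | u′ , walk-u′ , e with depth-k-handled inv u′ walk-u′
    ... | inj₂ done = inj₂ (nbrs-of-visited u (done u e))
    ... | inj₁ Lu′ with ∨-elim {vis u} (nbrs-covered G vis Lf u′ u Lu′ e)
    ... | inj₁ vu = inj₂ (nbrs-of-visited u vu)
    ... | inj₂ Nu with R u in Ru
    ... | false = inj₁ (∧-intro Nu refl)
    ... | true  = inj₂ (λ w e′ → nbrs-covered G vis₁ Pfull u w (∨-introʳ {Pf u} (∧-intro Nu Ru)) e′)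

    -- A landmark first reached at depth k+1 goes to the prune queue, whose neighbours get visited.
    nbrs-of-new-landmark : ∀ x → R x ≡ true → Walk G r x (suc k) → ∀ w → E G x w ≡ true → vis₂ w ≡ true
    nbrs-of-new-landmark x Rx walk with depth-k-handled′ x walk
    ... | inj₁ Lx   = ⊥-elim (true≢false (trans (sym Rx) (not-elim (proj₂ (∧-elim {N x} Lx)))))
    ... | inj₂ done = done

    via-at-next-depth : ∀ w → ViaLandmark w (suc (suc k)) → vis₂ w ≡ true
    via-at-next-depth w (x , Rx , x≢r , a , zero , walk-x , step e here , len) =
      nbrs-of-new-landmark x Rx (subst (Walk G r x) a≡ walk-x) w e
      where
      a≡ : a ≡ suc k
      a≡ = suc-injective (trans (+-comm 1 a) len)
    via-at-next-depth w (x , Rx , x≢r , a , suc b , walk-x , walk-w , len) with unsnoc G walk-w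
    ... | u , walk-u , e = nbrs-of-visited u (via-visited inv u (suc k) ≤-refl via-u) w e
      where
      via-u : ViaLandmark u (suc k)
      via-u = x , Rx , x≢r , a , b , walk-x , walk-u , suc-injective (trans (sym (+-suc a (suc b))) len)

    via-visited′ : ∀ w m → m ≤ suc (suc k) → ViaLandmark w m → vis₂ w ≡ true
    via-visited′ w m m≤ via with ≤-suc-cases m≤
    ... | inj₁ m≤k+1 = vis⇒vis₂ w (via-visited inv w m m≤k+1 via)
    ... | inj₂ refl  = via-at-next-depth w via

    visited-reason′ : ∀ u → vis₂ u ≡ true → (Σ ℕ λ j → j ≤ suc k × Walk G r u j) ⊎ M u ≡ true
    visited-reason′ u vu with ∨-elim {vis₁ u} vu
    ... | inj₂ Mu = inj₂ Mu
    ... | inj₁ vu₁ with ∨-elim {vis u} vu₁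
    ... | inj₂ Nu with unvisitedNbr-elim G vis Lf u Nu
    ... | _ , u′ , Lu′ , e = inj₁ (suc k , ≤-refl , snoc G (label-at-depth inv u′ Lu′) e)
    visited-reason′ u vu | inj₁ vu₁ | inj₁ vu₀ with visited-reason inv u vu₀
    ... | inj₁ (j , j≤k , walk) = inj₁ (j , m≤n⇒m≤1+n j≤k , walk)
    ... | inj₂ Pu = inj₁ (suc k , ≤-refl , prune-at-depth inv u Pu)

    new-at-depth : ∀ u → N u ≡ true → Walk G r u (suc k)
    new-at-depth u Nu with unvisitedNbr-elim G vis Lf u Nu
    ... | _ , u′ , Lu′ , e = snoc G (label-at-depth inv u′ Lu′) e

    prune-at-depth′ : ∀ u → M u ≡ true → Walk G r u (suc (suc k))
    prune-at-depth′ u Mu with unvisitedNbr-elim G vis₁ Pfull u Mu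
    ... | _ , u′ , Pu′ , e with ∨-elim {Pf u′} Pu′
    ... | inj₁ old = snoc G (prune-at-depth inv u′ old) e
    ... | inj₂ new = snoc G (new-at-depth u′ (proj₁ (∧-elim {N u′} new))) e

    label-at-depth′ : ∀ u → Lnext u ≡ true → Walk G r u (suc k)
    label-at-depth′ u Lu = new-at-depth u (proj₁ (∧-elim {N u} Lu))

    -- A new entry (r , k+1) goes to a vertex that was still unvisited, hence not reachable
    -- through a landmark within k+1 steps.
    labels-sound′ : SoundLabels (λ v → if Lnext v then just (suc k) else lbl v)
    labels-sound′ v d h with Lnext v in Lv
    ... | false = labels-sound inv v d h
    labels-sound′ v d refl | true with unvisitedNbr-elim G vis Lf v (proj₁ (∧-elim {N v} Lv))
    ... | unvis , _ = label-at-depth′ v Lv , shorter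
      where
      shorter : ∀ m → ViaLandmark v m → suc k < m
      shorter m via = ≰⇒> (λ m≤ → true≢false (trans (sym (via-visited inv v m m≤ via)) unvis))

    preserved : Invariant (suc k) (bfsRound G R k (st vis Lf Pf lbl))
    preserved = record
      { near-visited = near-visited′ ; via-visited = via-visited′
      ; depth-k-handled = depth-k-handled′ ; visited-reason = visited-reason′
      ; prune-at-depth = prune-at-depth′ ; label-at-depth = label-at-depth′
      ; labels-sound = labels-sound′ }

  run-sound : ∀ f k s → Invariant k s → SoundLabels (BFSState.lbl (bfsRun G R f k s))
  run-sound zero    k s                     inv = labels-sound inv
  run-sound (suc f) k (st vis Lf Pf lbl) inv = run-sound f (suc k) _ (Round.preserved k vis Lf Pf lbl inv)

  isRoot : Fin n → Bool
  isRoot v = ⌊ v ≟ r ⌋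

  isRoot-sound : ∀ v → isRoot v ≡ true → v ≡ r
  isRoot-sound v h with v ≟ r
  ... | yes v≡r = v≡r

  isRoot-root : isRoot r ≡ true
  isRoot-root with r ≟ r
  ... | yes _  = refl
  ... | no r≢r = ⊥-elim (r≢r refl)

  -- Initially only the root is visited and in the label frontier.  A landmark walk needs a
  -- landmark x ≠ r (so at least one edge before x) and one edge after x: length ≥ 2.
  initial : Invariant 0 (st isRoot isRoot (λ _ → false) (λ _ → nothing))
  initial = record
    { near-visited = near ; via-visited = via ; depth-k-handled = handled
    ; visited-reason = reason ; prune-at-depth = λ _ ()
    ; label-at-depth = λ u h → subst (λ x → Walk G r x 0) (sym (isRoot-sound u h)) here
    ; labels-sound = λ _ _ () }
    where
    near : ∀ w j → j ≤ 0 → Walk G r w j → isRoot w ≡ true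
    near w .0 z≤n walk with walk-length-0 G walk
    ... | refl = isRoot-root
    via : ∀ w m → m ≤ 1 → ViaLandmark w m → isRoot w ≡ true
    via w m m≤ (x , _ , x≢r , zero , _ , walk-x , _) = ⊥-elim (x≢r (sym (walk-length-0 G walk-x)))
    via w m m≤ (x , _ , _ , suc a , b , _ , _ , refl) with subst (_≤ 0) (+-suc a b) (s≤s⁻¹ m≤)
    ... | ()
    handled : ∀ u → Walk G r u 0 → isRoot u ≡ true ⊎ _
    handled u walk with walk-length-0 G walk
    ... | refl = inj₁ isRoot-root
    reason : ∀ u → isRoot u ≡ true → (Σ ℕ λ j → j ≤ 0 × Walk G r u j) ⊎ false ≡ true
    reason u h with isRoot-sound u h
    ... | refl = inj₁ (0 , z≤n , here)

  prunedBFS-sound : SoundLabels (prunedBFS G R r)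
  prunedBFS-sound = run-sound n 0 _ initial

  -- The only landmark on a shortest r–v path to a non-landmark v carrying a sound entry is r:
  -- any other landmark x would give a walk r ⇝ x ⇝ v of length d(r,v) ≤ d avoiding property (b).
  only-root-hub : ∀ v d → R v ≡ false → Walk G r v d × (∀ m → ViaLandmark v m → d < m) →
    ∀ x → R x ≡ true → OnShortestPath G r x v → x ≡ r
  only-root-hub v d Rv _ x Rx (_ , zero , _ , _ , (walk-xv , _) , _) with walk-length-0 G walk-xv
  ... | refl = ⊥-elim (true≢false (trans (sym Rx) Rv))
  only-root-hub v d Rv (walk-d , shorter) x Rx
                (a , suc b , c , (walk-rx , _) , (walk-xv , _) , (_ , shortest) , a+b≡c) with x ≟ r
  ... | yes x≡r = x≡r
  ... | no x≢r  = ⊥-elim (<⇒≱ (shorter c (x , Rx , x≢r , a , b , walk-rx , walk-xv , a+b≡c))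
                               (shortest d walk-d))

-- If Algorithm 1 gives v an entry for landmark r, then so does every highway cover labelling:
-- the hub that the cover property provides for (v , v , r) must be r itself.
entries-forced : ∀ {n} (G : Graph n) (R : Fin n → Bool) (L′ : Labelling n) →
  IsHighwayCoverLabelling G R L′ → ∀ v → R v ≡ false → ∀ r →
  is-just (algorithm1 G R v r) ≡ true → is-just (L′ v r) ≡ true
entries-forced G R L′ (distLabel , cover) v Rv r entry with R r in Rr
... | true with prunedBFS G R r v in found
... | just d with proj₁ (cover v v r Rv Rv Rr)
... | hub , dₕ , L′hub , hub-on-path
    with PrunedBFS.only-root-hub G R r v d Rv (PrunedBFS.prunedBFS-sound G R r v d found)
                                 hub (proj₁ (distLabel v hub dₕ Rv L′hub)) hub-on-path
... | refl rewrite L′hub = refl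

sum-mono : ∀ {A : Set} (f g : A → ℕ) (xs : List A) → (∀ x → f x ≤ g x) → sum (map f xs) ≤ sum (map g xs)
sum-mono f g []       f≤g = z≤n
sum-mono f g (x ∷ xs) f≤g = +-mono-≤ (f≤g x) (sum-mono f g xs f≤g)

count-mono : ∀ {n} (p q : Fin n → Bool) → (∀ x → p x ≡ true → q x ≡ true) → count p ≤ count q
count-mono {n} p q p⇒q = sum-mono _ _ (allFin n) indicator-mono
  where
  indicator-mono : ∀ x → (if p x then 1 else 0) ≤ (if q x then 1 else 0)
  indicator-mono x with p x in px
  ... | false = z≤n
  ... | true rewrite p⇒q x px = ≤-refl

size-mono : ∀ {n} (R : Fin n → Bool) (L L′ : Labelling n) →
  (∀ v → R v ≡ false → ∀ r → is-just (L v r) ≡ true → is-just (L′ v r) ≡ true) →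
  size R L ≤ size R L′
size-mono {n} R L L′ L⊆L′ = sum-mono _ _ (allFin n) per-vertex
  where
  per-vertex : ∀ v → (if R v then 0 else count (λ r → is-just (L v r)))
                   ≤ (if R v then 0 else count (λ r → is-just (L′ v r)))
  per-vertex v with R v in Rv
  ... | true  = z≤n
  ... | false = count-mono _ _ (L⊆L′ v Rv)

-- Theorem 3.12: the labelling of Algorithm 1 has minimum size among highway cover labellings.
theorem3p12 : (n : ℕ) (G : Graph n) → Connected G → (R : Fin n → Bool) →
    (L′ : Labelling n) → IsHighwayCoverLabelling G R L′ →
    size R L′ ≥ size R (algorithm1 G R)
theorem3p12 n G _ R L′ cover = size-mono R (algorithm1 G R) L′ (entries-forced G R L′ cover)
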